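{- Let $G$ be a finite simple graph and let $S,T\in\Psi(G)$. Then there exists a perfect matching (a set of pairwise disjoint edges of $G$, each joining a vertex of $S\cap N(T)$ to a vertex of $T\cap N(S)$, covering both sets) between $S\cap N(T)$ and $T\cap N(S)$. In particular, $|S\cap N(T)|=|T\cap N(S)|$.
   Context: For a graph $G$ and $X\subseteq V(G)$, $N(X)$ is the set of vertices adjacent to some vertex of $X$ and $N[X]=X\cup N(X)$; $G[X]$ is the induced subgraph on $X$. A set $S\subseteq V(G)$ is a local maximum independent set of $G$ if $S$ is a maximum independent set of $G[N[S]]$; $\Psi(G)$ denotes the family of all local maximum independent sets of $G$. -}

module Defs where

open import Data.Nat using (ℕ; _≤_)
open import Data.Bool using (Bool; true; false; _∧_; _∨_)
open import Data.Fin using (Fin)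
open import Data.Fin.Subset using (Subset; _∈_; _⊆_; _∪_; ∣_∣)
open import Data.Vec using (tabulate; lookup; foldr′)
open import Data.Product using (Σ; ∃; _×_)
open import Relation.Binary.PropositionalEquality using (_≡_)

record Graph (n : ℕ) : Set where
  field
    adj    : Fin n → Fin n → Bool
    sym    : ∀ u v → adj u v ≡ adj v u
    irrefl : ∀ v → adj v v ≡ false
open Graph public

N : ∀ {n} → Graph n → Subset n → Subset n
N G X = tabulate (λ v → foldr′ _∨_ false (tabulate (λ u → lookup X u ∧ adj G u v)))

N[_] : ∀ {n} → Graph n → Subset n → Subset n
N[_] G X = X ∪ N G X

Independent : ∀ {n} → Graph n → Subset n → Set
Independent G X = ∀ u v → u ∈ X → v ∈ X → adj G u v ≡ false

MaxIndependentIn : ∀ {n} → Graph n → Subset n → Subset n → Set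
MaxIndependentIn G U X =
  X ⊆ U × Independent G X × (∀ I → I ⊆ U → Independent G I → ∣ I ∣ ≤ ∣ X ∣)

-- S ∈ Ψ(G): S is a maximum independent set of G[N[S]].
LocalMaxIndependent : ∀ {n} → Graph n → Subset n → Set
LocalMaxIndependent G S = MaxIndependentIn G (N[ G ] S) S

-- A perfect matching between A and B: a bijection f : A → B such that
-- every x ∈ A is joined by an edge of G to f x (the edges {x, f x}, x ∈ A).
PerfectMatching : ∀ {n} → Graph n → Subset n → Subset n → Set
PerfectMatching {n} G A B =
  Σ (Fin n → Fin n) λ f →
    (∀ x → x ∈ A → f x ∈ B × adj G x (f x) ≡ true) ×
    (∀ x y → x ∈ A → y ∈ A → f x ≡ f y → x ≡ y) ×
    (∀ y → y ∈ B → ∃ λ x → x ∈ A × f x ≡ y)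

{-# OPTIONS --safe #-}

-- The Hall condition for S ∩ N(T) against T ∩ N(S) is an exchange argument:
-- for X ⊆ S ∩ N(T), the set (T ∖ N(X)) ∪ X is independent and lies in N[T],
-- so local maximality of T gives |T ∖ N(X)| + |X| ≤ |T|, i.e. |X| ≤ |T ∩ N(X)|.
-- Hall's theorem (proved by the usual induction on critical subsets) then
-- matches each side into the other; the two injections force equal sizes,
-- which makes either matching perfect.

module Submission where

open import Data.Bool using (Bool; true; false; _∧_; _∨_)
open import Data.Bool.Properties using (¬-not; ∧-conicalˡ; ∧-conicalʳ)
open import Data.Empty using (⊥-elim)
open import Data.Fin using (Fin; zero; suc; _≟_)
open import Data.Fin.Properties using (any?)
open import Data.Fin.Subset
  using (Subset; inside; outside; _∈_; _∉_; _⊆_; _⊂_; _∩_; _∪_; _─_; _-_; ⁅_⁆; ∣_∣; Nonempty; Empty)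
open import Data.Fin.Subset.Properties
  using ( _∈?_; nonempty?; _⊂?_; anySubset?; Empty-unique; ∣⊥∣≡0; ∣⁅x⁆∣≡1; x∈⁅x⁆; x∈⁅y⁆⇒x≡y
        ; x∉⁅y⁆⇒x≢y; ⊆-trans; p⊆q⇒∣p∣≤∣q∣; x∈p∩q⁺; x∈p∩q⁻; x∈p∪q⁺; x∈p∪q⁻; x∈p∧x∉q⇒x∈p─q
        ; p─q⊆p; p∩q≢∅⇒p─q⊂p; x∈p∧x≢y⇒x∈p-y; x∈p⇒p-x⊂p; x∈p⇒∣p-x∣<∣p∣)
open import Data.Fin.Subset.Induction using (Acc; acc; ⊂-wellFounded)
open import Data.Nat using (ℕ; zero; suc; _+_; _≤_; _<_; _≤?_; z≤n; s≤s)
open import Data.Nat.Properties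
  using (+-suc; +-identityʳ; m≤m+n; +-monoʳ-≤; +-cancelˡ-≤; +-cancelʳ-≤; ≤-trans; ≤-pred; ≤-antisym
        ; <-irrefl; ≰⇒>; n>0⇒n≢0; module ≤-Reasoning)
open import Data.Product using (_×_; _,_; proj₁; proj₂; ∃)
open import Data.Sum using (inj₁; inj₂)
open import Data.Vec using ([]; _∷_; here; there; tabulate; lookup; foldr′)
open import Data.Vec.Properties using (lookup∘tabulate; []=⇒lookup; lookup⇒[]=)
open import Relation.Nullary using (Dec; yes; no; ¬_; contradiction)
open import Relation.Nullary.Decidable using (_×-dec_)
open import Relation.Binary.PropositionalEquality
  using (_≡_; _≢_; refl; sym; trans; cong; subst; module ≡-Reasoning)

open import Defs hiding (sym)

private
  variable
    n : ℕ
    p q : Subset n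
    x y : Fin n

x∈p─q⁻ : ∀ (p q : Subset n) → x ∈ p ─ q → x ∈ p × x ∉ q
x∈p─q⁻ (inside ∷ p) (outside ∷ q) here = here , λ ()
x∈p─q⁻ {x = zero} (outside ∷ p) (outside ∷ q) ()
x∈p─q⁻ {x = zero} (_ ∷ p) (inside ∷ q) ()
x∈p─q⁻ (s ∷ p) (t ∷ q) (there x∈p─q) =
  let x∈p , x∉q = x∈p─q⁻ p q x∈p─q in there x∈p , λ { (there x∈q) → x∉q x∈q }

x∈p⇒⁅x⁆⊆p : x ∈ p → ⁅ x ⁆ ⊆ p
x∈p⇒⁅x⁆⊆p {x = x} x∈p y∈⁅x⁆ = subst (_∈ _) (sym (x∈⁅y⁆⇒x≡y x y∈⁅x⁆)) x∈p

p∩q─r⊆p─r∩q : ∀ (p q r : Subset n) → (p ∩ q) ─ r ⊆ (p ─ r) ∩ q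
p∩q─r⊆p─r∩q p q r x∈ =
  let x∈p∩q , x∉r = x∈p─q⁻ (p ∩ q) r x∈
      x∈p , x∈q = x∈p∩q⁻ p q x∈p∩q
  in x∈p∩q⁺ (x∈p∧x∉q⇒x∈p─q x∈p x∉r , x∈q)

∣p∣≡∣p─q∣+∣p∩q∣ : ∀ (p q : Subset n) → ∣ p ∣ ≡ ∣ p ─ q ∣ + ∣ p ∩ q ∣
∣p∣≡∣p─q∣+∣p∩q∣ []            []            = refl
∣p∣≡∣p─q∣+∣p∩q∣ (inside  ∷ p) (inside  ∷ q) = trans (cong suc (∣p∣≡∣p─q∣+∣p∩q∣ p q)) (sym (+-suc _ _))
∣p∣≡∣p─q∣+∣p∩q∣ (inside  ∷ p) (outside ∷ q) = cong suc (∣p∣≡∣p─q∣+∣p∩q∣ p q)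
∣p∣≡∣p─q∣+∣p∩q∣ (outside ∷ p) (inside  ∷ q) = ∣p∣≡∣p─q∣+∣p∩q∣ p q
∣p∣≡∣p─q∣+∣p∩q∣ (outside ∷ p) (outside ∷ q) = ∣p∣≡∣p─q∣+∣p∩q∣ p q

∣p∪q∣+∣p∩q∣≡∣p∣+∣q∣ : ∀ (p q : Subset n) → ∣ p ∪ q ∣ + ∣ p ∩ q ∣ ≡ ∣ p ∣ + ∣ q ∣
∣p∪q∣+∣p∩q∣≡∣p∣+∣q∣ []            []            = refl
∣p∪q∣+∣p∩q∣≡∣p∣+∣q∣ (inside  ∷ p) (inside  ∷ q) =
  cong suc (trans (+-suc _ _) (trans (cong suc (∣p∪q∣+∣p∩q∣≡∣p∣+∣q∣ p q)) (sym (+-suc _ _))))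
∣p∪q∣+∣p∩q∣≡∣p∣+∣q∣ (inside  ∷ p) (outside ∷ q) = cong suc (∣p∪q∣+∣p∩q∣≡∣p∣+∣q∣ p q)
∣p∪q∣+∣p∩q∣≡∣p∣+∣q∣ (outside ∷ p) (inside  ∷ q) =
  trans (cong suc (∣p∪q∣+∣p∩q∣≡∣p∣+∣q∣ p q)) (sym (+-suc _ _))
∣p∪q∣+∣p∩q∣≡∣p∣+∣q∣ (outside ∷ p) (outside ∷ q) = ∣p∪q∣+∣p∩q∣≡∣p∣+∣q∣ p q

∣p∪q∣≤∣p∣+∣q∣ : ∀ (p q : Subset n) → ∣ p ∪ q ∣ ≤ ∣ p ∣ + ∣ q ∣
∣p∪q∣≤∣p∣+∣q∣ p q = subst (∣ p ∪ q ∣ ≤_) (∣p∪q∣+∣p∩q∣≡∣p∣+∣q∣ p q) (m≤m+n _ _)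

Empty⇒∣p∣≡0 : Empty p → ∣ p ∣ ≡ 0
Empty⇒∣p∣≡0 {n} empty = trans (cong ∣_∣ (Empty-unique empty)) (∣⊥∣≡0 n)

Empty⇒∣p∣≤m : ∀ {m} → Empty p → ∣ p ∣ ≤ m
Empty⇒∣p∣≤m empty = subst (_≤ _) (sym (Empty⇒∣p∣≡0 empty)) z≤n

0<∣p∣⇒Nonempty : 0 < ∣ p ∣ → Nonempty p
0<∣p∣⇒Nonempty {p = p} 0<∣p∣ with nonempty? p
... | yes nonempty = nonempty
... | no  empty    = contradiction (Empty⇒∣p∣≡0 empty) (n>0⇒n≢0 0<∣p∣)

Empty[p∩q]⇒∣p∪q∣≡∣p∣+∣q∣ : ∀ (p q : Subset n) → Empty (p ∩ q) → ∣ p ∪ q ∣ ≡ ∣ p ∣ + ∣ q ∣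
Empty[p∩q]⇒∣p∪q∣≡∣p∣+∣q∣ p q disjoint = begin
  ∣ p ∪ q ∣               ≡⟨ sym (+-identityʳ _) ⟩
  ∣ p ∪ q ∣ + 0           ≡⟨ cong (∣ p ∪ q ∣ +_) (sym (Empty⇒∣p∣≡0 disjoint)) ⟩
  ∣ p ∪ q ∣ + ∣ p ∩ q ∣   ≡⟨ ∣p∪q∣+∣p∩q∣≡∣p∣+∣q∣ p q ⟩
  ∣ p ∣ + ∣ q ∣           ∎
  where open ≡-Reasoning

∣p∣≤1+∣p-x∣ : ∀ (p : Subset n) x → ∣ p ∣ ≤ suc ∣ p - x ∣
∣p∣≤1+∣p-x∣ p x = begin
  ∣ p ∣                   ≤⟨ p⊆q⇒∣p∣≤∣q∣ p⊆⁅x⁆∪p-x ⟩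
  ∣ ⁅ x ⁆ ∪ (p - x) ∣     ≤⟨ ∣p∪q∣≤∣p∣+∣q∣ ⁅ x ⁆ (p - x) ⟩
  ∣ ⁅ x ⁆ ∣ + ∣ p - x ∣   ≡⟨ cong (_+ ∣ p - x ∣) (∣⁅x⁆∣≡1 x) ⟩
  suc ∣ p - x ∣           ∎
  where
  open ≤-Reasoning
  p⊆⁅x⁆∪p-x : p ⊆ ⁅ x ⁆ ∪ (p - x)
  p⊆⁅x⁆∪p-x {y} y∈p with y ≟ x
  ... | yes refl = x∈p∪q⁺ (inj₁ (x∈⁅x⁆ y))
  ... | no  y≢x  = x∈p∪q⁺ (inj₂ (x∈p∧x≢y⇒x∈p-y y∈p y≢x))

MapsTo : (Fin n → Fin n) → Subset n → Subset n → Set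
MapsTo f p q = ∀ {x} → x ∈ p → f x ∈ q

InjectiveOn : (Fin n → Fin n) → Subset n → Set
InjectiveOn f p = ∀ {x y} → x ∈ p → y ∈ p → f x ≡ f y → x ≡ y

injectiveOn⇒∣p∣≤∣q∣ : ∀ (f : Fin n → Fin n) → MapsTo f p q → InjectiveOn f p → ∣ p ∣ ≤ ∣ q ∣
injectiveOn⇒∣p∣≤∣q∣ f = go (⊂-wellFounded _)
  where
  go : ∀ {p q} → Acc _⊂_ p → MapsTo f p q → InjectiveOn f p → ∣ p ∣ ≤ ∣ q ∣
  go {p} {q} (acc rec) f[p]⊆q inj with nonempty? p
  ... | no  empty      = Empty⇒∣p∣≤m empty
  ... | yes (a , a∈p)  = begin
    ∣ p ∣             ≤⟨ ∣p∣≤1+∣p-x∣ p a ⟩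
    suc ∣ p - a ∣     ≤⟨ s≤s (go (rec (x∈p⇒p-x⊂p a∈p)) f[p-a]⊆q-fa inj-p-a) ⟩
    suc ∣ q - f a ∣   ≤⟨ x∈p⇒∣p-x∣<∣p∣ (f[p]⊆q a∈p) ⟩
    ∣ q ∣             ∎
    where
    open ≤-Reasoning
    f[p-a]⊆q-fa : MapsTo f (p - a) (q - f a)
    f[p-a]⊆q-fa x∈p-a =
      let x∈p , x∉⁅a⁆ = x∈p─q⁻ p ⁅ a ⁆ x∈p-a in
      x∈p∧x≢y⇒x∈p-y (f[p]⊆q x∈p) (λ fx≡fa → x∉⁅y⁆⇒x≢y x∉⁅a⁆ (inj x∈p a∈p fx≡fa))
    inj-p-a : InjectiveOn f (p - a)
    inj-p-a x∈ y∈ = inj (p─q⊆p p _ x∈) (p─q⊆p p _ y∈)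

injectiveOn∧∣q∣≤∣p∣⇒onto : ∀ (f : Fin n → Fin n) → MapsTo f p q → InjectiveOn f p → ∣ q ∣ ≤ ∣ p ∣ →
                            y ∈ q → ∃ λ x → x ∈ p × f x ≡ y
injectiveOn∧∣q∣≤∣p∣⇒onto {p = p} {q} {y} f f[p]⊆q inj ∣q∣≤∣p∣ y∈q with any? (λ x → x ∈? p ×-dec f x ≟ y)
... | yes hit  = hit
... | no  miss = ⊥-elim (<-irrefl refl (begin-strict
  ∣ q ∣       ≤⟨ ∣q∣≤∣p∣ ⟩
  ∣ p ∣       ≤⟨ injectiveOn⇒∣p∣≤∣q∣ f f[p]⊆q-y inj ⟩
  ∣ q - y ∣   <⟨ x∈p⇒∣p-x∣<∣p∣ y∈q ⟩
  ∣ q ∣       ∎))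
  where
  open ≤-Reasoning
  f[p]⊆q-y : MapsTo f p (q - y)
  f[p]⊆q-y x∈p = x∈p∧x≢y⇒x∈p-y (f[p]⊆q x∈p) (λ fx≡y → miss (_ , x∈p , fx≡y))

∨-tabulate⁺ : ∀ {m} (g : Fin m → Bool) i → g i ≡ true → foldr′ _∨_ false (tabulate g) ≡ true
∨-tabulate⁺ g zero    gi≡true rewrite gi≡true = refl
∨-tabulate⁺ g (suc i) gi≡true with g zero
... | true  = refl
... | false = ∨-tabulate⁺ (λ j → g (suc j)) i gi≡true

∨-tabulate⁻ : ∀ {m} (g : Fin m → Bool) → foldr′ _∨_ false (tabulate g) ≡ true → ∃ λ i → g i ≡ true
∨-tabulate⁻ {suc m} g any≡true with g zero in g0
... | true  = zero , g0
... | false = let i , gi≡true = ∨-tabulate⁻ (λ j → g (suc j)) any≡true in suc i , gi≡true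

-- N G is definitionally Γ (adj G).
Γ : (Fin n → Fin n → Bool) → Subset n → Subset n
Γ R X = tabulate (λ v → foldr′ _∨_ false (tabulate (λ u → lookup X u ∧ R u v)))

module _ {n} (R : Fin n → Fin n → Bool) where

  v∈Γ⁺ : ∀ {X u v} → u ∈ X → R u v ≡ true → v ∈ Γ R X
  v∈Γ⁺ {X} {u} {v} u∈X Ruv =
    lookup⇒[]= v (Γ R X) (trans (lookup∘tabulate _ v) (∨-tabulate⁺ _ u edge))
    where
    edge : lookup X u ∧ R u v ≡ true
    edge rewrite []=⇒lookup u∈X | Ruv = refl

  v∈Γ⁻ : ∀ {X v} → v ∈ Γ R X → ∃ λ u → u ∈ X × R u v ≡ true
  v∈Γ⁻ {X} {v} v∈ΓX
    with ∨-tabulate⁻ (λ u → lookup X u ∧ R u v) (trans (sym (lookup∘tabulate _ v)) ([]=⇒lookup v∈ΓX))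
  ... | u , edge = u , lookup⇒[]= u X (∧-conicalˡ _ _ edge) , ∧-conicalʳ _ _ edge

  Γ-mono : ∀ {X Y} → X ⊆ Y → Γ R X ⊆ Γ R Y
  Γ-mono X⊆Y v∈ΓX = let u , u∈X , Ruv = v∈Γ⁻ v∈ΓX in v∈Γ⁺ (X⊆Y u∈X) Ruv

  Γ-∪ : ∀ X Y → Γ R (X ∪ Y) ⊆ Γ R X ∪ Γ R Y
  Γ-∪ X Y v∈ with v∈Γ⁻ v∈
  ... | u , u∈X∪Y , Ruv with x∈p∪q⁻ X Y u∈X∪Y
  ...   | inj₁ u∈X = x∈p∪q⁺ (inj₁ (v∈Γ⁺ u∈X Ruv))
  ...   | inj₂ u∈Y = x∈p∪q⁺ (inj₂ (v∈Γ⁺ u∈Y Ruv))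

  HallCondition : Subset n → Subset n → Set
  HallCondition A B = ∀ X → X ⊆ A → ∣ X ∣ ≤ ∣ B ∩ Γ R X ∣

  record Matching (A B : Subset n) : Set where
    field
      match     : Fin n → Fin n
      maps-to   : MapsTo match A B
      injective : InjectiveOn match A
      edge      : ∀ {x} → x ∈ A → R x (match x) ≡ true

  Matching⇒∣A∣≤∣B∣ : ∀ {A B} → Matching A B → ∣ A ∣ ≤ ∣ B ∣
  Matching⇒∣A∣≤∣B∣ m = injectiveOn⇒∣p∣≤∣q∣ match maps-to injective
    where open Matching m

  Empty⇒Matching : ∀ {A B} → Empty A → Matching A B
  Empty⇒Matching empty = record
    { match     = λ x → x
    ; maps-to   = λ x∈A → ⊥-elim (empty (_ , x∈A))
    ; injective = λ x∈A _ _ → ⊥-elim (empty (_ , x∈A))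
    ; edge      = λ x∈A → ⊥-elim (empty (_ , x∈A))
    }

  edge⇒Matching : ∀ {a b B} → R a b ≡ true → b ∈ B → Matching ⁅ a ⁆ B
  edge⇒Matching {a} {b} Rab b∈B = record
    { match     = λ _ → b
    ; maps-to   = λ _ → b∈B
    ; injective = λ x∈⁅a⁆ y∈⁅a⁆ _ → trans (x∈⁅y⁆⇒x≡y a x∈⁅a⁆) (sym (x∈⁅y⁆⇒x≡y a y∈⁅a⁆))
    ; edge      = λ x∈⁅a⁆ → subst (λ x → R x b ≡ true) (sym (x∈⁅y⁆⇒x≡y a x∈⁅a⁆)) Rab
    }

  glue : ∀ {A B C X} → X ⊆ A → Matching X (B ∩ C) → Matching (A ─ X) (B ─ C) → Matching A B
  glue {A} {B} {C} {X} X⊆A m₁ m₂ = record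
    { match = f ; maps-to = f[A]⊆B ; injective = f-injective ; edge = f-edge }
    where
    module M₁ = Matching m₁
    module M₂ = Matching m₂

    f : Fin n → Fin n
    f x with x ∈? X
    ... | yes _ = M₁.match x
    ... | no  _ = M₂.match x

    f[A]⊆B : MapsTo f A B
    f[A]⊆B {x} x∈A with x ∈? X
    ... | yes x∈X = proj₁ (x∈p∩q⁻ B C (M₁.maps-to x∈X))
    ... | no  x∉X = p─q⊆p B C (M₂.maps-to (x∈p∧x∉q⇒x∈p─q x∈A x∉X))

    f-edge : ∀ {x} → x ∈ A → R x (f x) ≡ true
    f-edge {x} x∈A with x ∈? X
    ... | yes x∈X = M₁.edge x∈X
    ... | no  x∉X = M₂.edge (x∈p∧x∉q⇒x∈p─q x∈A x∉X)

    separated : ∀ {x y} → x ∈ X → y ∈ A ─ X → M₁.match x ≢ M₂.match y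
    separated x∈X y∈A─X f₁x≡f₂y =
      proj₂ (x∈p─q⁻ B C (M₂.maps-to y∈A─X)) (subst (_∈ C) f₁x≡f₂y (proj₂ (x∈p∩q⁻ B C (M₁.maps-to x∈X))))

    f-injective : InjectiveOn f A
    f-injective {x} {y} x∈A y∈A fx≡fy with x ∈? X | y ∈? X
    ... | yes x∈X | yes y∈X = M₁.injective x∈X y∈X fx≡fy
    ... | no  x∉X | no  y∉X = M₂.injective (x∈p∧x∉q⇒x∈p─q x∈A x∉X) (x∈p∧x∉q⇒x∈p─q y∈A y∉X) fx≡fy
    ... | yes x∈X | no  y∉X = ⊥-elim (separated x∈X (x∈p∧x∉q⇒x∈p─q y∈A y∉X) fx≡fy)
    ... | no  x∉X | yes y∈X = ⊥-elim (separated y∈X (x∈p∧x∉q⇒x∈p─q x∈A x∉X) (sym fx≡fy))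

  HallCondition-⊆ : ∀ {A B X} → HallCondition A B → X ⊆ A → HallCondition X (B ∩ Γ R X)
  HallCondition-⊆ {B = B} {X} hall X⊆A Y Y⊆X =
    ≤-trans (hall Y (⊆-trans Y⊆X X⊆A)) (p⊆q⇒∣p∣≤∣q∣ B∩ΓY⊆B∩ΓX∩ΓY)
    where
    B∩ΓY⊆B∩ΓX∩ΓY : B ∩ Γ R Y ⊆ (B ∩ Γ R X) ∩ Γ R Y
    B∩ΓY⊆B∩ΓX∩ΓY z∈ = let z∈B , z∈ΓY = x∈p∩q⁻ B _ z∈ in
      x∈p∩q⁺ (x∈p∩q⁺ (z∈B , Γ-mono Y⊆X z∈ΓY) , z∈ΓY)

  HallCondition-─ : ∀ {A B X} → HallCondition A B → X ⊆ A → ∣ B ∩ Γ R X ∣ ≤ ∣ X ∣ →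
                    HallCondition (A ─ X) (B ─ Γ R X)
  HallCondition-─ {A} {B} {X} hall X⊆A critical Y Y⊆A─X = +-cancelʳ-≤ _ _ _ (begin
    ∣ Y ∣ + ∣ X ∣               ≡⟨ Empty[p∩q]⇒∣p∪q∣≡∣p∣+∣q∣ Y X Y∩X-empty ⟨
    ∣ Y ∪ X ∣                   ≤⟨ hall (Y ∪ X) Y∪X⊆A ⟩
    ∣ B ∩ Γ R (Y ∪ X) ∣         ≤⟨ p⊆q⇒∣p∣≤∣q∣ split ⟩
    ∣ Z ∪ (B ∩ Γ R X) ∣         ≤⟨ ∣p∪q∣≤∣p∣+∣q∣ Z _ ⟩
    ∣ Z ∣ + ∣ B ∩ Γ R X ∣       ≤⟨ +-monoʳ-≤ ∣ Z ∣ critical ⟩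
    ∣ Z ∣ + ∣ X ∣               ∎)
    where
    open ≤-Reasoning
    Z : Subset n
    Z = (B ─ Γ R X) ∩ Γ R Y

    Y∩X-empty : Empty (Y ∩ X)
    Y∩X-empty (y , y∈Y∩X) = let y∈Y , y∈X = x∈p∩q⁻ Y X y∈Y∩X in proj₂ (x∈p─q⁻ A X (Y⊆A─X y∈Y)) y∈X

    Y∪X⊆A : Y ∪ X ⊆ A
    Y∪X⊆A y∈ with x∈p∪q⁻ Y X y∈
    ... | inj₁ y∈Y = p─q⊆p A X (Y⊆A─X y∈Y)
    ... | inj₂ y∈X = X⊆A y∈X

    split : B ∩ Γ R (Y ∪ X) ⊆ Z ∪ (B ∩ Γ R X)
    split {z} z∈ with x∈p∩q⁻ B _ z∈
    ... | z∈B , z∈Γ[Y∪X] with z ∈? Γ R X | x∈p∪q⁻ (Γ R Y) (Γ R X) (Γ-∪ Y X z∈Γ[Y∪X])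
    ...   | yes z∈ΓX | _          = x∈p∪q⁺ (inj₂ (x∈p∩q⁺ (z∈B , z∈ΓX)))
    ...   | no  z∉ΓX | inj₁ z∈ΓY  = x∈p∪q⁺ (inj₁ (x∈p∩q⁺ (x∈p∧x∉q⇒x∈p─q z∈B z∉ΓX , z∈ΓY)))
    ...   | no  z∉ΓX | inj₂ z∈ΓX  = contradiction z∈ΓX z∉ΓX

  Surplus : Subset n → Subset n → Set
  Surplus A B = ∀ X → X ⊂ A → Nonempty X → ∣ X ∣ < ∣ B ∩ Γ R X ∣

  Surplus⇒HallCondition : ∀ {A B a} b → Surplus A B → a ∈ A → HallCondition (A - a) (B - b)
  Surplus⇒HallCondition {A} {B} {a} b surplus a∈A Y Y⊆A-a with nonempty? Y
  ... | no  empty    = Empty⇒∣p∣≤m empty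
  ... | yes nonempty = ≤-pred (begin-strict
    ∣ Y ∣                   <⟨ surplus Y Y⊂A nonempty ⟩
    ∣ B ∩ Γ R Y ∣           ≤⟨ ∣p∣≤1+∣p-x∣ (B ∩ Γ R Y) b ⟩
    suc ∣ (B ∩ Γ R Y) - b ∣ ≤⟨ s≤s (p⊆q⇒∣p∣≤∣q∣ (p∩q─r⊆p─r∩q B (Γ R Y) ⁅ b ⁆)) ⟩
    suc ∣ (B - b) ∩ Γ R Y ∣ ∎)
    where
    open ≤-Reasoning
    Y⊂A : Y ⊂ A
    Y⊂A = (λ y∈Y → p─q⊆p A _ (Y⊆A-a y∈Y))
        , a , a∈A , (λ a∈Y → proj₂ (x∈p─q⁻ A _ (Y⊆A-a a∈Y)) (x∈⁅x⁆ a))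

  HallCondition⇒edge : ∀ {A B a} → HallCondition A B → a ∈ A → ∃ λ b → b ∈ B × R a b ≡ true
  HallCondition⇒edge {B = B} {a} hall a∈A =
    let b , b∈B∩Γa = 0<∣p∣⇒Nonempty 0<∣B∩Γa∣
        b∈B , b∈Γa = x∈p∩q⁻ B _ b∈B∩Γa
        u , u∈⁅a⁆ , Rub = v∈Γ⁻ b∈Γa
    in b , b∈B , subst (λ u → R u b ≡ true) (x∈⁅y⁆⇒x≡y a u∈⁅a⁆) Rub
    where
    0<∣B∩Γa∣ : 0 < ∣ B ∩ Γ R ⁅ a ⁆ ∣
    0<∣B∩Γa∣ = subst (_≤ ∣ B ∩ Γ R ⁅ a ⁆ ∣) (∣⁅x⁆∣≡1 a) (hall ⁅ a ⁆ (x∈p⇒⁅x⁆⊆p a∈A))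

  Critical : Subset n → Subset n → Subset n → Set
  Critical A B X = X ⊂ A × Nonempty X × ∣ B ∩ Γ R X ∣ ≤ ∣ X ∣

  critical? : ∀ A B X → Dec (Critical A B X)
  critical? A B X = X ⊂? A ×-dec nonempty? X ×-dec ∣ B ∩ Γ R X ∣ ≤? ∣ X ∣

  ¬Critical⇒Surplus : ∀ {A B} → ¬ ∃ (Critical A B) → Surplus A B
  ¬Critical⇒Surplus no-critical X X⊂A nonempty =
    ≰⇒> (λ ∣B∩ΓX∣≤∣X∣ → no-critical (X , X⊂A , nonempty , ∣B∩ΓX∣≤∣X∣))

  -- Recursion on ⊂: split A along a critical subset if there is one, otherwise along one edge.
  hall : ∀ {A B} → HallCondition A B → Matching A B
  hall = go (⊂-wellFounded _)
    where
    go : ∀ {A B} → Acc _⊂_ A → HallCondition A B → Matching A B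
    go {A} {B} (acc rec) hc with nonempty? A | anySubset? (critical? A B)
    ... | no A-empty | _ = Empty⇒Matching A-empty
    ... | yes _ | yes (X , X⊂A@(X⊆A , _) , (x , x∈X) , critical) =
      glue X⊆A (go (rec X⊂A) (HallCondition-⊆ {B = B} hc X⊆A))
               (go (rec A─X⊂A) (HallCondition-─ {B = B} hc X⊆A critical))
      where
      A─X⊂A : A ─ X ⊂ A
      A─X⊂A = p∩q≢∅⇒p─q⊂p A X (x , x∈p∩q⁺ (X⊆A x∈X , x∈X))
    ... | yes (a , a∈A) | no no-critical =
      let b , b∈B , Rab = HallCondition⇒edge {B = B} hc a∈A in
      glue (x∈p⇒⁅x⁆⊆p a∈A) (edge⇒Matching Rab (x∈p∩q⁺ (b∈B , x∈⁅x⁆ b)))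
           (go (rec (x∈p⇒p-x⊂p a∈A))
               (Surplus⇒HallCondition {B = B} b (¬Critical⇒Surplus {B = B} no-critical) a∈A))

module _ {n} (G : Graph n) where

  Independent-⊆ : ∀ {S X} → Independent G S → X ⊆ S → Independent G X
  Independent-⊆ indS X⊆S u v u∈X v∈X = indS u v (X⊆S u∈X) (X⊆S v∈X)

  Independent⇒x∉N : ∀ {T x} → Independent G T → x ∈ T → x ∉ N G T
  Independent⇒x∉N {x = x} indT x∈T x∈NT with v∈Γ⁻ (adj G) x∈NT
  ... | t , t∈T , adj-tx with trans (sym adj-tx) (indT t x t∈T x∈T)
  ... | ()

  exchange-Independent : ∀ {X T} → Independent G X → Independent G T → Independent G ((T ─ N G X) ∪ X)
  exchange-Independent {X} {T} indX indT u v u∈ v∈ with x∈p∪q⁻ (T ─ N G X) X u∈ | x∈p∪q⁻ (T ─ N G X) X v∈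
  ... | inj₁ u∈T─NX | inj₁ v∈T─NX = indT u v (p─q⊆p T _ u∈T─NX) (p─q⊆p T _ v∈T─NX)
  ... | inj₂ u∈X    | inj₂ v∈X    = indX u v u∈X v∈X
  ... | inj₁ u∈T─NX | inj₂ v∈X    =
    ¬-not λ adj-uv → proj₂ (x∈p─q⁻ T _ u∈T─NX) (v∈Γ⁺ (adj G) v∈X (trans (Graph.sym G v u) adj-uv))
  ... | inj₂ u∈X    | inj₁ v∈T─NX =
    ¬-not λ adj-uv → proj₂ (x∈p─q⁻ T _ v∈T─NX) (v∈Γ⁺ (adj G) u∈X adj-uv)

  LocalMaxIndependent⇒∣X∣≤∣T∩NX∣ : ∀ {T X} → LocalMaxIndependent G T → Independent G X → X ⊆ N G T →
                                   ∣ X ∣ ≤ ∣ T ∩ N G X ∣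
  LocalMaxIndependent⇒∣X∣≤∣T∩NX∣ {T} {X} (_ , indT , maxT) indX X⊆NT =
    +-cancelˡ-≤ _ _ _ (begin
      ∣ T ─ N G X ∣ + ∣ X ∣         ≡⟨ Empty[p∩q]⇒∣p∪q∣≡∣p∣+∣q∣ (T ─ N G X) X disjoint ⟨
      ∣ (T ─ N G X) ∪ X ∣           ≤⟨ maxT _ exchange⊆N[T] (exchange-Independent indX indT) ⟩
      ∣ T ∣                         ≡⟨ ∣p∣≡∣p─q∣+∣p∩q∣ T (N G X) ⟩
      ∣ T ─ N G X ∣ + ∣ T ∩ N G X ∣ ∎)
    where
    open ≤-Reasoning
    disjoint : Empty ((T ─ N G X) ∩ X)
    disjoint (x , x∈) = let x∈T─NX , x∈X = x∈p∩q⁻ (T ─ N G X) X x∈ in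
      Independent⇒x∉N indT (p─q⊆p T _ x∈T─NX) (X⊆NT x∈X)
    exchange⊆N[T] : (T ─ N G X) ∪ X ⊆ N[ G ] T
    exchange⊆N[T] x∈ with x∈p∪q⁻ (T ─ N G X) X x∈
    ... | inj₁ x∈T─NX = x∈p∪q⁺ (inj₁ (p─q⊆p T _ x∈T─NX))
    ... | inj₂ x∈X    = x∈p∪q⁺ (inj₂ (X⊆NT x∈X))

  hallCondition : ∀ {S T} → Independent G S → LocalMaxIndependent G T →
                  HallCondition (adj G) (S ∩ N G T) (T ∩ N G S)
  hallCondition {S} {T} indS ψT X X⊆ =
    ≤-trans (LocalMaxIndependent⇒∣X∣≤∣T∩NX∣ ψT (Independent-⊆ indS X⊆S) X⊆NT) (p⊆q⇒∣p∣≤∣q∣ T∩NX⊆)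
    where
    X⊆S : X ⊆ S
    X⊆S x∈X = proj₁ (x∈p∩q⁻ S _ (X⊆ x∈X))
    X⊆NT : X ⊆ N G T
    X⊆NT x∈X = proj₂ (x∈p∩q⁻ S _ (X⊆ x∈X))
    T∩NX⊆ : T ∩ N G X ⊆ (T ∩ N G S) ∩ N G X
    T∩NX⊆ z∈ = let z∈T , z∈NX = x∈p∩q⁻ T _ z∈ in
      x∈p∩q⁺ (x∈p∩q⁺ (z∈T , Γ-mono (adj G) X⊆S z∈NX) , z∈NX)

  Matching⇒PerfectMatching : ∀ {A B} → Matching (adj G) A B → ∣ B ∣ ≤ ∣ A ∣ → PerfectMatching G A B
  Matching⇒PerfectMatching m ∣B∣≤∣A∣ =
      match
    , (λ _ x∈A → maps-to x∈A , edge x∈A)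
    , (λ _ _ → injective)
    , (λ _ → injectiveOn∧∣q∣≤∣p∣⇒onto match maps-to injective ∣B∣≤∣A∣)
    where open Matching m

lemma3p2 : ∀ {n} (G : Graph n) (S T : Subset n) →
    LocalMaxIndependent G S → LocalMaxIndependent G T →
    PerfectMatching G (S ∩ N G T) (T ∩ N G S) ×
    ∣ S ∩ N G T ∣ ≡ ∣ T ∩ N G S ∣
lemma3p2 G S T ψS@(_ , indS , _) ψT@(_ , indT , _) =
  Matching⇒PerfectMatching G S→T ∣T∩NS∣≤∣S∩NT∣ , ≤-antisym ∣S∩NT∣≤∣T∩NS∣ ∣T∩NS∣≤∣S∩NT∣
  where
  S→T : Matching (adj G) (S ∩ N G T) (T ∩ N G S)
  S→T = hall (adj G) (hallCondition G indS ψT)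
  T→S : Matching (adj G) (T ∩ N G S) (S ∩ N G T)
  T→S = hall (adj G) (hallCondition G indT ψS)
  ∣S∩NT∣≤∣T∩NS∣ : ∣ S ∩ N G T ∣ ≤ ∣ T ∩ N G S ∣
  ∣S∩NT∣≤∣T∩NS∣ = Matching⇒∣A∣≤∣B∣ (adj G) S→T
  ∣T∩NS∣≤∣S∩NT∣ : ∣ T ∩ N G S ∣ ≤ ∣ S ∩ N G T ∣
  ∣T∩NS∣≤∣S∩NT∣ = Matching⇒∣A∣≤∣B∣ (adj G) T→S
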